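{- Let $q$ be a prime power and let $L_q$ be the Levi graph (point–line incidence graph) of the Desarguesian projective plane $PG(2,q)$. Then $\sigma(L_q)>(q+1-\sqrt{q})/2$.
   Context: The Levi graph of $PG(2,q)$ is the bipartite graph whose vertices are the $q^2+q+1$ points and $q^2+q+1$ lines of the plane, a point adjacent to a line iff it lies on it. For a graph $G$, $\sigma(G)$ is the minimum of the maximum degree of $G[K]$ over vertex sets $K$ with $|K|>\alpha(G)$, $\alpha$ the independence number. -}

module Defs where

open import Level using (0ℓ)
open import Data.Nat using (ℕ; zero; suc; _⊔_; _<_; _≤_)
open import Data.Product using (Σ; ∃; _×_; _,_)
open import Data.Sum using (_⊎_; inj₁; inj₂)
open import Data.Empty using (⊥)
open import Data.List using (List; length; filter; foldr)
open import Data.List.Membership.Propositional using (_∈_)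
open import Data.List.Relation.Unary.Unique.Propositional using (Unique)
open import Relation.Nullary using (¬_; Dec; yes; no)
open import Relation.Unary using (Decidable)
open import Relation.Binary.PropositionalEquality using (_≡_)
open import Relation.Binary.Definitions using (DecidableEquality)
open import Algebra.Structures using (IsCommutativeRing)

record FiniteField : Set₁ where
  infixl 7 _*_
  infixl 6 _+_
  field
    Carrier           : Set
    _+_ _*_           : Carrier → Carrier → Carrier
    -_                : Carrier → Carrier
    0# 1#             : Carrier
    isCommutativeRing : IsCommutativeRing _≡_ _+_ _*_ -_ 0# 1#
    0≢1               : ¬ (0# ≡ 1#)
    inverse           : ∀ x → ¬ (x ≡ 0#) → Σ Carrier (λ y → x * y ≡ 1#)
    _≟_               : DecidableEquality Carrier
    elements          : List Carrier
    elements-unique   : Unique elements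
    elements-complete : ∀ x → x ∈ elements

  order : ℕ
  order = length elements

record Graph : Set₁ where
  field
    V     : Set
    _~_   : V → V → Set
    _~?_  : ∀ u v → Dec (u ~ v)

module _ (G : Graph) where
  open Graph G

  VertexSet : List V → Set
  VertexSet K = Unique K

  Independent : List V → Set
  Independent K = ∀ {u v} → u ∈ K → v ∈ K → ¬ (u ~ v)

  IsIndependenceNumber : ℕ → Set
  IsIndependenceNumber a =
    (Σ (List V) λ K → VertexSet K × Independent K × length K ≡ a)
    × (∀ K → VertexSet K → Independent K → length K ≤ a)

  degreeIn : List V → V → ℕ
  degreeIn K v = length (filter (λ u → v ~? u) K)

  -- maximum degree Δ(G[K]) (0 for the empty set)
  maxDegreeIn : List V → ℕ
  maxDegreeIn K = foldr (λ v m → degreeIn K v ⊔ m) 0 K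

  -- σ(G) = s : s is the minimum of Δ(G[K]) over vertex sets K with |K| > α(G)
  IsSigma : ℕ → Set
  IsSigma s = Σ ℕ λ a → IsIndependenceNumber a
    × (Σ (List V) λ K → VertexSet K × a < length K × maxDegreeIn K ≡ s)
    × (∀ K → VertexSet K → a < length K → s ≤ maxDegreeIn K)

-- Points are the 1-dimensional subspaces of F³, represented by their
-- normalised homogeneous coordinates (first nonzero coordinate = 1):
--   (1:a:b), (0:1:a), (0:0:1).  Lines are represented the same way by
-- their dual coordinates [u:v:w], the line u x + v y + w z = 0.

module _ (F : FiniteField) where
  open FiniteField F

  data Proj : Set where
    pt₁ : Carrier → Carrier → Proj
    pt₂ : Carrier → Proj
    pt₃ : Proj

  coords : Proj → Carrier × Carrier × Carrier
  coords (pt₁ a b) = 1# , a , b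
  coords (pt₂ a)   = 0# , 1# , a
  coords pt₃       = 0# , 0# , 1#

  dot : Carrier × Carrier × Carrier → Carrier × Carrier × Carrier → Carrier
  dot (x , y , z) (u , v , w) = x * u + y * v + z * w

  Incident : Proj → Proj → Set
  Incident p l = dot (coords p) (coords l) ≡ 0#

  -- vertices: inj₁ = points, inj₂ = lines
  LeviAdj : Proj ⊎ Proj → Proj ⊎ Proj → Set
  LeviAdj (inj₁ p) (inj₁ p′) = ⊥
  LeviAdj (inj₁ p) (inj₂ l)  = Incident p l
  LeviAdj (inj₂ l) (inj₁ p)  = Incident p l
  LeviAdj (inj₂ l) (inj₂ l′) = ⊥

  LeviAdj? : ∀ u v → Dec (LeviAdj u v)
  LeviAdj? (inj₁ p) (inj₁ p′) = no (λ ())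
  LeviAdj? (inj₁ p) (inj₂ l)  = dot (coords p) (coords l) ≟ 0#
  LeviAdj? (inj₂ l) (inj₁ p)  = dot (coords p) (coords l) ≟ 0#
  LeviAdj? (inj₂ l) (inj₂ l′) = no (λ ())

  Levi : Graph
  Levi = record { V = Proj ⊎ Proj ; _~_ = LeviAdj ; _~?_ = LeviAdj? }

-- Let K be a vertex set of the Levi graph with |K| > α and maximum degree s.  The
-- n = q² + q + 1 points form an independent set, so K consists of a set P of a points and a
-- set L of b lines with a + b > n, and counting the I incidences between P and L from either
-- side gives I ≤ s · min(a, b).  Cauchy–Schwarz, applied to the numbers of lines of L through
-- the points inside and outside P, together with the fact that two lines meet in at most one
-- point, gives the expander-mixing bound
--   (a b (q + 1) − n I)² ≤ q · a (n − a) · b (n − b) < q (a b)²,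
-- the last step because n − a < b and n − b < a.  With m = min(a, b) and M = max(a, b) the
-- left-hand side is at least (m (M (q + 1) − n s))², so M (q + 1) − n s < √q · M, and n < 2M
-- turns this into q + 1 − 2s < √q.

module Submission where

open import Defs
open import Data.Product using (∃-syntax; _×_; _,_; proj₁; proj₂)
open import Data.Sum using (_⊎_; inj₁; inj₂; [_,_]′)
open import Data.Empty using (⊥; ⊥-elim)
open import Function using (_∘_; _∘′_; _⇔_; Equivalence; mk⇔)
open import Data.List using (List; []; _∷_; _++_; map; length; filter; foldr; cartesianProductWith)
open import Data.List.Properties using (length-map)
open import Data.List.Membership.Propositional using (_∈_)
open import Data.List.Relation.Unary.Any using (here; there)
import Data.List.Relation.Unary.All as All
import Data.List.Relation.Unary.AllPairs as AllPairs
open import Data.List.Relation.Unary.Unique.Propositional using (Unique)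
open import Relation.Nullary using (¬_; Dec; yes; no; _×-dec_; contradiction)
open import Relation.Binary.Definitions using (DecidableEquality)
open import Relation.Binary.PropositionalEquality hiding (J)

module Summation where

  open import Data.Nat using (ℕ; zero; suc; _+_; _*_; _∸_; _≤_; z≤n; s≤s)
  open import Data.Nat.Properties
  open import Data.Nat.Tactic.RingSolver using (solve-∀)

  ∑ : {A : Set} → List A → (A → ℕ) → ℕ
  ∑ []       f = 0
  ∑ (x ∷ xs) f = f x + ∑ xs f

  infix 5 ∑
  syntax ∑ xs (λ x → e) = ∑[ x ∈ xs ] e

  module _ {A : Set} where

    ∑-++ : ∀ (xs ys : List A) f → ∑ (xs ++ ys) f ≡ ∑ xs f + ∑ ys f
    ∑-++ []       ys f = refl
    ∑-++ (x ∷ xs) ys f = trans (cong (f x +_) (∑-++ xs ys f)) (sym (+-assoc (f x) _ _))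

    ∑-map : ∀ {B : Set} (g : A → B) (xs : List A) f → ∑ (map g xs) f ≡ ∑[ x ∈ xs ] f (g x)
    ∑-map g []       f = refl
    ∑-map g (x ∷ xs) f = cong (f (g x) +_) (∑-map g xs f)

    ∑-cong∈ : ∀ (xs : List A) {f g} → (∀ {x} → x ∈ xs → f x ≡ g x) → ∑ xs f ≡ ∑ xs g
    ∑-cong∈ []       f≗g = refl
    ∑-cong∈ (x ∷ xs) f≗g = cong₂ _+_ (f≗g (here refl)) (∑-cong∈ xs (f≗g ∘′ there))

    ∑-cong : ∀ (xs : List A) {f g} → (∀ x → f x ≡ g x) → ∑ xs f ≡ ∑ xs g
    ∑-cong xs f≗g = ∑-cong∈ xs (λ {x} _ → f≗g x)

    ∑-mono∈-≤ : ∀ (xs : List A) {f g} → (∀ {x} → x ∈ xs → f x ≤ g x) → ∑ xs f ≤ ∑ xs g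
    ∑-mono∈-≤ []       f≤g = z≤n
    ∑-mono∈-≤ (x ∷ xs) f≤g = +-mono-≤ (f≤g (here refl)) (∑-mono∈-≤ xs (f≤g ∘′ there))

    ∑-mono-≤ : ∀ (xs : List A) {f g} → (∀ x → f x ≤ g x) → ∑ xs f ≤ ∑ xs g
    ∑-mono-≤ xs f≤g = ∑-mono∈-≤ xs (λ {x} _ → f≤g x)

    ∑-const : ∀ (xs : List A) c → ∑ xs (λ _ → c) ≡ c * length xs
    ∑-const []       c = sym (*-zeroʳ c)
    ∑-const (x ∷ xs) c = trans (cong (c +_) (∑-const xs c)) (sym (*-suc c (length xs)))

    ∑-length : ∀ (xs : List A) → ∑ xs (λ _ → 1) ≡ length xs
    ∑-length xs = trans (∑-const xs 1) (*-identityˡ (length xs))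

    ∑-zero : ∀ (xs : List A) {f} → (∀ {x} → x ∈ xs → f x ≡ 0) → ∑ xs f ≡ 0
    ∑-zero xs f≗0 = trans (∑-cong∈ xs f≗0) (trans (∑-const xs 0) (*-zeroˡ (length xs)))

    ∑-distrib-+ : ∀ (xs : List A) f g → ∑[ x ∈ xs ] (f x + g x) ≡ ∑ xs f + ∑ xs g
    ∑-distrib-+ []       f g = refl
    ∑-distrib-+ (x ∷ xs) f g =
      trans (cong (f x + g x +_) (∑-distrib-+ xs f g)) (+-interchange (f x) (g x) _ _)
      where
      +-interchange : ∀ a b c d → a + b + (c + d) ≡ a + c + (b + d)
      +-interchange = solve-∀

    *-distribˡ-∑ : ∀ (xs : List A) c f → ∑[ x ∈ xs ] c * f x ≡ c * ∑ xs f
    *-distribˡ-∑ []       c f = sym (*-zeroʳ c)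
    *-distribˡ-∑ (x ∷ xs) c f =
      trans (cong (c * f x +_) (*-distribˡ-∑ xs c f)) (sym (*-distribˡ-+ c (f x) _))

    *-distribʳ-∑ : ∀ (xs : List A) c f → ∑[ x ∈ xs ] f x * c ≡ ∑ xs f * c
    *-distribʳ-∑ xs c f =
      trans (∑-cong xs (λ x → *-comm (f x) c)) (trans (*-distribˡ-∑ xs c f) (*-comm c _))

  ∑-comm : ∀ {A B : Set} (xs : List A) (ys : List B) (f : A → B → ℕ) →
    ∑[ x ∈ xs ] ∑[ y ∈ ys ] f x y ≡ ∑[ y ∈ ys ] ∑[ x ∈ xs ] f x y
  ∑-comm []       ys f = sym (∑-zero ys (λ _ → refl))
  ∑-comm (x ∷ xs) ys f = trans (cong (∑ ys (f x) +_) (∑-comm xs ys f))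
    (sym (∑-distrib-+ ys (f x) (λ y → ∑[ x′ ∈ xs ] f x′ y)))

  ∑-cartesianProductWith : ∀ {A B C : Set} (g : A → B → C) (xs : List A) (ys : List B) f →
    ∑ (cartesianProductWith g xs ys) f ≡ ∑[ x ∈ xs ] ∑[ y ∈ ys ] f (g x y)
  ∑-cartesianProductWith g []       ys f = refl
  ∑-cartesianProductWith g (x ∷ xs) ys f = begin
    ∑ (map (g x) ys ++ cartesianProductWith g xs ys) f
      ≡⟨ ∑-++ (map (g x) ys) _ f ⟩
    ∑ (map (g x) ys) f + ∑ (cartesianProductWith g xs ys) f
      ≡⟨ cong₂ _+_ (∑-map (g x) ys f) (∑-cartesianProductWith g xs ys f) ⟩
    (∑[ y ∈ ys ] f (g x y)) + (∑[ x′ ∈ xs ] ∑[ y ∈ ys ] f (g x′ y)) ∎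
    where open ≡-Reasoning

  𝟙 : {P : Set} → Dec P → ℕ
  𝟙 (yes _) = 1
  𝟙 (no _)  = 0

  𝟙-yes : {P : Set} (P? : Dec P) → P → 𝟙 P? ≡ 1
  𝟙-yes (yes _) _  = refl
  𝟙-yes (no ¬p) p = contradiction p ¬p

  𝟙-no : {P : Set} (P? : Dec P) → ¬ P → 𝟙 P? ≡ 0
  𝟙-no (yes p) ¬p = contradiction p ¬p
  𝟙-no (no _)  _  = refl

  𝟙-idem : {P : Set} (P? : Dec P) → 𝟙 P? * 𝟙 P? ≡ 𝟙 P?
  𝟙-idem (yes _) = refl
  𝟙-idem (no _)  = refl

  𝟙-cong : {P Q : Set} → P ⇔ Q → (P? : Dec P) (Q? : Dec Q) → 𝟙 P? ≡ 𝟙 Q?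
  𝟙-cong P⇔Q (yes p) Q? = sym (𝟙-yes Q? (Equivalence.to P⇔Q p))
  𝟙-cong P⇔Q (no ¬p) Q? = sym (𝟙-no Q? (¬p ∘′ Equivalence.from P⇔Q))

  𝟙-× : {P Q : Set} (P? : Dec P) (Q? : Dec Q) → 𝟙 (P? ×-dec Q?) ≡ 𝟙 P? * 𝟙 Q?
  𝟙-× (yes _) (yes _) = refl
  𝟙-× (yes _) (no _)  = refl
  𝟙-× (no _)  _       = refl

  module _ {A : Set} {P : A → Set} (P? : ∀ x → Dec (P x)) where

    length-filter≡∑𝟙 : ∀ xs → length (filter P? xs) ≡ ∑[ x ∈ xs ] 𝟙 (P? x)
    length-filter≡∑𝟙 []       = refl
    length-filter≡∑𝟙 (x ∷ xs) with P? x
    ... | yes _ = cong suc (length-filter≡∑𝟙 xs)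
    ... | no _  = length-filter≡∑𝟙 xs

    ∑𝟙≤1 : ∀ {xs} → Unique xs → (∀ {x y} → P x → P y → x ≡ y) → ∑[ x ∈ xs ] 𝟙 (P? x) ≤ 1
    ∑𝟙≤1 {[]}     AllPairs.[]         _      = z≤n
    ∑𝟙≤1 {x ∷ xs} (x∉ AllPairs.∷ xs!) P-prop with P? x
    ... | no _  = ∑𝟙≤1 xs! P-prop
    ... | yes p = s≤s (≤-reflexive (∑-zero xs (λ y∈ →
            𝟙-no (P? _) (λ q → All.lookup x∉ y∈ (P-prop p q)))))

  ∑-complement : ∀ {A : Set} (xs : List A) (c f : A → ℕ) → (∀ x → c x ≤ 1) →
    (∑[ x ∈ xs ] c x * f x) + (∑[ x ∈ xs ] (1 ∸ c x) * f x) ≡ ∑ xs f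
  ∑-complement xs c f c≤1 = trans (sym (∑-distrib-+ xs _ _)) (∑-cong xs λ x → begin
    c x * f x + (1 ∸ c x) * f x ≡⟨ *-distribʳ-+ (f x) (c x) (1 ∸ c x) ⟨
    (c x + (1 ∸ c x)) * f x     ≡⟨ cong (_* f x) (m+[n∸m]≡n (c≤1 x)) ⟩
    1 * f x                     ≡⟨ *-identityˡ (f x) ⟩
    f x                         ∎)
    where open ≡-Reasoning

  module _ {A : Set} (_≟_ : DecidableEquality A) where

    multiplicity : List A → A → ℕ
    multiplicity xs x = ∑[ y ∈ xs ] 𝟙 (x ≟ y)

    multiplicity≤1 : ∀ {xs} → Unique xs → ∀ x → multiplicity xs x ≤ 1
    multiplicity≤1 xs! x = ∑𝟙≤1 (x ≟_) xs! (λ x≡y x≡z → trans (sym x≡y) x≡z)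

    ∑-δ : ∀ {xs y} (f : A → ℕ) → Unique xs → y ∈ xs → ∑[ x ∈ xs ] 𝟙 (x ≟ y) * f x ≡ f y
    ∑-δ {z ∷ zs} f (z∉zs AllPairs.∷ zs!) (here refl) = begin
      𝟙 (z ≟ z) * f z + (∑[ x ∈ zs ] 𝟙 (x ≟ z) * f x)
        ≡⟨ cong₂ _+_ (cong (_* f z) (𝟙-yes (z ≟ z) refl)) (∑-zero zs λ x∈zs →
             cong (_* f _) (𝟙-no (_ ≟ z) λ x≡z → All.lookup z∉zs x∈zs (sym x≡z))) ⟩
      1 * f z + 0 ≡⟨ +-identityʳ (1 * f z) ⟩
      1 * f z     ≡⟨ *-identityˡ (f z) ⟩
      f z         ∎
      where open ≡-Reasoning
    ∑-δ {z ∷ zs} f (z∉zs AllPairs.∷ zs!) (there y∈zs) =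
      trans (cong (λ c → c * f z + (∑[ x ∈ zs ] 𝟙 (x ≟ _) * f x)) (𝟙-no (z ≟ _) (All.lookup z∉zs y∈zs)))
            (∑-δ f zs! y∈zs)

    module Enumeration (univ : List A) (univ! : Unique univ) (∈univ : ∀ x → x ∈ univ) where

      ∑-multiplicity : ∀ xs f → ∑[ x ∈ univ ] multiplicity xs x * f x ≡ ∑ xs f
      ∑-multiplicity xs f = begin
        ∑[ x ∈ univ ] multiplicity xs x * f x
          ≡⟨ ∑-cong univ (λ x → *-distribʳ-∑ xs (f x) (λ y → 𝟙 (x ≟ y))) ⟨
        ∑[ x ∈ univ ] ∑[ y ∈ xs ] 𝟙 (x ≟ y) * f x
          ≡⟨ ∑-comm univ xs (λ x y → 𝟙 (x ≟ y) * f x) ⟩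
        ∑[ y ∈ xs ] ∑[ x ∈ univ ] 𝟙 (x ≟ y) * f x
          ≡⟨ ∑-cong xs (λ y → ∑-δ f univ! (∈univ y)) ⟩
        ∑ xs f ∎
        where open ≡-Reasoning

      ∑-multiplicity-length : ∀ xs → ∑[ x ∈ univ ] multiplicity xs x ≡ length xs
      ∑-multiplicity-length xs =
        trans (∑-cong univ (λ x → sym (*-identityʳ (multiplicity xs x))))
              (trans (∑-multiplicity xs (λ _ → 1)) (∑-length xs))

      outside : List A → ℕ
      outside xs = ∑[ x ∈ univ ] (1 ∸ multiplicity xs x)

      length+outside : ∀ {xs} → Unique xs → length xs + outside xs ≡ length univ
      length+outside {xs} xs! = begin
        length xs + outside xs
          ≡⟨ cong₂ _+_ (∑-multiplicity-length xs) refl ⟨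
        (∑[ x ∈ univ ] multiplicity xs x) + outside xs
          ≡⟨ cong₂ _+_ (∑-cong univ λ x → *-identityʳ _) (∑-cong univ λ x → *-identityʳ _) ⟨
        (∑[ x ∈ univ ] multiplicity xs x * 1) + (∑[ x ∈ univ ] (1 ∸ multiplicity xs x) * 1)
          ≡⟨ ∑-complement univ (multiplicity xs) (λ _ → 1) (multiplicity≤1 xs!) ⟩
        ∑ univ (λ _ → 1)
          ≡⟨ ∑-length univ ⟩
        length univ ∎
        where open ≡-Reasoning

      ∑𝟙-unique : ∀ {P : A → Set} (P? : ∀ x → Dec (P x)) {x₀} → (∀ {x} → P x ⇔ x ≡ x₀) →
        ∑[ x ∈ univ ] 𝟙 (P? x) ≡ 1
      ∑𝟙-unique P? P⇔≡x₀ =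
        trans (∑-cong univ (λ x → trans (𝟙-cong P⇔≡x₀ (P? x) (x ≟ _)) (sym (*-identityʳ _))))
              (∑-δ (λ _ → 1) univ! (∈univ _))

  2xy≤x²+y²-ordered : ∀ {x y} → x ≤ y → 2 * (x * y) ≤ x * x + y * y
  2xy≤x²+y²-ordered {x} x≤y with m≤n⇒∃[o]m+o≡n x≤y
  ... | k , refl = ≤-trans (m≤m+n _ (k * k)) (≤-reflexive (expand x k))
    where
    expand : ∀ x k → 2 * (x * (x + k)) + k * k ≡ x * x + (x + k) * (x + k)
    expand = solve-∀

  2xy≤x²+y² : ∀ x y → 2 * (x * y) ≤ x * x + y * y
  2xy≤x²+y² x y with ≤-total x y
  ... | inj₁ x≤y = 2xy≤x²+y²-ordered x≤y
  ... | inj₂ y≤x =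
    subst₂ _≤_ (cong (2 *_) (*-comm y x)) (+-comm (y * y) (x * x)) (2xy≤x²+y²-ordered y≤x)

  cross-term-bound : ∀ b S W T → S * S ≤ W * T → 2 * b * S ≤ T + W * (b * b)
  cross-term-bound b zero    zero     T _  = ≤-trans (≤-reflexive (*-zeroʳ (2 * b))) z≤n
  cross-term-bound b (suc S) zero     T ()
  cross-term-bound b S W@(suc _) T S²≤WT = *-cancelˡ-≤ W (begin
    W * (2 * b * S)               ≡⟨ regroup W b S ⟩
    2 * ((W * b) * S)             ≤⟨ 2xy≤x²+y² (W * b) S ⟩
    (W * b) * (W * b) + S * S     ≤⟨ +-monoʳ-≤ ((W * b) * (W * b)) S²≤WT ⟩
    (W * b) * (W * b) + W * T     ≡⟨ factor W b T ⟩
    W * (T + W * (b * b))         ∎)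
    where
    open ≤-Reasoning
    regroup : ∀ W b S → W * (2 * b * S) ≡ 2 * ((W * b) * S)
    regroup = solve-∀
    factor : ∀ W b T → (W * b) * (W * b) + W * T ≡ W * (T + W * (b * b))
    factor = solve-∀

  cauchy-schwarz : ∀ {A : Set} (xs : List A) (w f : A → ℕ) →
    let S = ∑[ x ∈ xs ] w x * f x in
    S * S ≤ ∑ xs w * (∑[ x ∈ xs ] w x * (f x * f x))
  cauchy-schwarz []       w f = z≤n
  cauchy-schwarz (x ∷ xs) w f = begin
    (a * b + S) * (a * b + S)                        ≡⟨ expand a b S ⟩
    a * b * (a * b) + a * (2 * b * S) + S * S
      ≤⟨ +-mono-≤ (+-monoʳ-≤ (a * b * (a * b)) (*-monoʳ-≤ a (cross-term-bound b S W T ih))) ih ⟩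
    a * b * (a * b) + a * (T + W * (b * b)) + W * T  ≡⟨ factor a b W T ⟩
    (a + W) * (a * (b * b) + T)                      ∎
    where
    open ≤-Reasoning
    a = w x
    b = f x
    S = ∑[ y ∈ xs ] w y * f y
    W = ∑ xs w
    T = ∑[ y ∈ xs ] w y * (f y * f y)
    ih = cauchy-schwarz xs w f
    expand : ∀ a b S → (a * b + S) * (a * b + S) ≡ a * b * (a * b) + a * (2 * b * S) + S * S
    expand = solve-∀
    factor : ∀ a b W T → a * b * (a * b) + a * (T + W * (b * b)) + W * T ≡ (a + W) * (a * (b * b) + T)
    factor = solve-∀

module Arithmetic where

  open import Data.Nat using (ℕ; zero; suc; _+_; _*_; _∸_; _^_; _≤_; _<_; _<?_; z≤n; s≤s; >-nonZero)
  open import Data.Nat.Properties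
  open import Data.Nat.Tactic.RingSolver using (solve-∀; solve)

  deficit-identity : ∀ a a′ I J D → a′ * I + D ≡ a * J →
    D * D + a * a′ * ((I + J) * (I + J)) ≡ (a + a′) * (a′ * (I * I) + a * (J * J))
  deficit-identity a a′ I J D a′I+D≡aJ = begin
    D * D + a * a′ * ((I + J) * (I + J))
      ≡⟨ solve (a ∷ a′ ∷ I ∷ J ∷ D ∷ []) ⟩
    D * D + a * a′ * (I * I) + 2 * a′ * I * (a * J) + a′ * J * (a * J)
      ≡⟨ cong (λ X → D * D + a * a′ * (I * I) + 2 * a′ * I * X + a′ * J * X) a′I+D≡aJ ⟨
    D * D + a * a′ * (I * I) + 2 * a′ * I * (a′ * I + D) + a′ * J * (a′ * I + D)
      ≡⟨ solve (a ∷ a′ ∷ I ∷ J ∷ D ∷ []) ⟩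
    a * a′ * (I * I) + a′ * a′ * (I * I) + (a′ * I + D) * (a′ * I + D) + a′ * J * (a′ * I + D)
      ≡⟨ cong (λ X → a * a′ * (I * I) + a′ * a′ * (I * I) + X * X + a′ * J * X) a′I+D≡aJ ⟩
    a * a′ * (I * I) + a′ * a′ * (I * I) + (a * J) * (a * J) + a′ * J * (a * J)
      ≡⟨ solve (a ∷ a′ ∷ I ∷ J ∷ D ∷ []) ⟩
    (a + a′) * (a′ * (I * I) + a * (J * J)) ∎
    where open ≡-Reasoning

  plane-identity : ∀ {q n b b′} → n ≡ q * q + q + 1 → b + b′ ≡ n →
    n * (b * (q + b)) ≡ (b * (q + 1)) * (b * (q + 1)) + q * b * b′
  plane-identity {q} {n} {b} {b′} n≡ b+b′≡n = begin
    n * (b * (q + b))                            ≡⟨ solve (q ∷ n ∷ b ∷ []) ⟩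
    b * b * n + q * b * n                        ≡⟨ cong₂ (λ u v → b * b * u + q * b * v) n≡ (sym b+b′≡n) ⟩
    b * b * (q * q + q + 1) + q * b * (b + b′)   ≡⟨ solve (q ∷ b ∷ b′ ∷ []) ⟩
    (b * (q + 1)) * (b * (q + 1)) + q * b * b′   ∎
    where open ≡-Reasoning

  -- I and J count the incidences of b lines with the a points of a set and the a′ points outside it,
  -- S and S′ the corresponding sums of squared numbers of lines through a point.
  deficit-bound : ∀ {q n a a′ b b′ I J S S′ D} →
    n ≡ q * q + q + 1 → a + a′ ≡ n → b + b′ ≡ n →
    I + J ≡ b * (q + 1) → S + S′ ≤ b * (q + b) → I * I ≤ a * S → J * J ≤ a′ * S′ →
    n * I + D ≡ a * b * (q + 1) → D * D ≤ q * (a * b) * (a′ * b′)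
  deficit-bound {q} {n} {a} {a′} {b} {b′} {I} {J} {S} {S′} {D}
                n≡ a+a′≡n b+b′≡n I+J≡ S+S′≤ I²≤aS J²≤a′S′ nI+D≡ =
    +-cancelˡ-≤ (a * a′ * (F * F)) (D * D) (q * (a * b) * (a′ * b′)) (begin
      a * a′ * (F * F) + D * D                   ≡⟨ +-comm _ (D * D) ⟩
      D * D + a * a′ * (F * F)                   ≡⟨ cong (λ z → D * D + a * a′ * (z * z)) I+J≡ ⟨
      D * D + a * a′ * ((I + J) * (I + J))       ≡⟨ deficit-identity a a′ I J D a′I+D≡aJ ⟩
      (a + a′) * (a′ * (I * I) + a * (J * J))    ≡⟨ cong (_* (a′ * (I * I) + a * (J * J))) a+a′≡n ⟩
      n * (a′ * (I * I) + a * (J * J))           ≤⟨ *-monoʳ-≤ n weighted ⟩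
      n * (a * a′ * (b * (q + b)))               ≡⟨ solve (n ∷ a ∷ a′ ∷ b ∷ q ∷ []) ⟩
      a * a′ * (n * (b * (q + b)))               ≡⟨ cong (a * a′ *_) (plane-identity {q} n≡ b+b′≡n) ⟩
      a * a′ * (F * F + q * b * b′)              ≡⟨ regroup a a′ b b′ q F ⟩
      a * a′ * (F * F) + q * (a * b) * (a′ * b′) ∎)
    where
    open ≤-Reasoning
    F = b * (q + 1)
    regroup : ∀ a a′ b b′ q F → a * a′ * (F * F + q * b * b′) ≡ a * a′ * (F * F) + q * (a * b) * (a′ * b′)
    regroup = solve-∀
    weighted : a′ * (I * I) + a * (J * J) ≤ a * a′ * (b * (q + b))
    weighted = begin
      a′ * (I * I) + a * (J * J)     ≤⟨ +-mono-≤ (*-monoʳ-≤ a′ I²≤aS) (*-monoʳ-≤ a J²≤a′S′) ⟩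
      a′ * (a * S) + a * (a′ * S′)   ≡⟨ solve (a ∷ a′ ∷ S ∷ S′ ∷ []) ⟩
      a * a′ * (S + S′)              ≤⟨ *-monoʳ-≤ (a * a′) S+S′≤ ⟩
      a * a′ * (b * (q + b))         ∎
    a′I+D≡aJ : a′ * I + D ≡ a * J
    a′I+D≡aJ = +-cancelˡ-≡ (a * I) (a′ * I + D) (a * J) (begin-equality
      a * I + (a′ * I + D)   ≡⟨ solve (a ∷ a′ ∷ I ∷ D ∷ []) ⟩
      (a + a′) * I + D       ≡⟨ cong (λ z → z * I + D) a+a′≡n ⟩
      n * I + D              ≡⟨ nI+D≡ ⟩
      a * b * (q + 1)        ≡⟨ *-assoc a b (q + 1) ⟩
      a * F                  ≡⟨ cong (a *_) I+J≡ ⟨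
      a * (I + J)            ≡⟨ *-distribˡ-+ a I J ⟩
      a * I + a * J          ∎)

  complement-product : ∀ {n a a′ b b′} → a + a′ ≡ n → b + b′ ≡ n → n < a + b → a′ * b′ < a * b
  complement-product {n} {a} {a′} {b} {b′} a+a′≡n b+b′≡n n<a+b =
    subst (a′ * b′ <_) (*-comm b a) (*-mono-< a′<b b′<a)
    where
    a′<b : a′ < b
    a′<b = +-cancelˡ-< a a′ b (subst (_< a + b) (sym a+a′≡n) n<a+b)
    b′<a : b′ < a
    b′<a = +-cancelˡ-< b b′ a (subst₂ _<_ (sym b+b′≡n) (+-comm a b) n<a+b)

  -- Write 2M = n + B and 2s + t = q + 1; then R = B (q + 1) + n t is twice M (q + 1) − n s.
  excess≤deficit : ∀ {q n s t m M B I} → 2 * s + t ≡ q + 1 → M + M ≡ n + B → I ≤ s * m →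
    2 * (n * I) + m * (B * (q + 1) + n * t) ≤ 2 * (m * M * (q + 1))
  excess≤deficit {q} {n} {s} {t} {m} {M} {B} {I} 2s+t≡ 2M≡ I≤sm = begin
    2 * (n * I) + m * (B * (q + 1) + n * t)
      ≤⟨ +-monoˡ-≤ (m * (B * (q + 1) + n * t)) (*-monoʳ-≤ 2 (*-monoʳ-≤ n I≤sm)) ⟩
    2 * (n * (s * m)) + m * (B * (q + 1) + n * t)
      ≡⟨ solve (q ∷ n ∷ s ∷ t ∷ m ∷ B ∷ []) ⟩
    m * n * (2 * s + t) + m * B * (q + 1)   ≡⟨ cong (λ z → m * n * z + m * B * (q + 1)) 2s+t≡ ⟩
    m * n * (q + 1) + m * B * (q + 1)       ≡⟨ solve (q ∷ n ∷ m ∷ B ∷ []) ⟩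
    m * (n + B) * (q + 1)                   ≡⟨ cong (λ z → m * z * (q + 1)) 2M≡ ⟨
    m * (M + M) * (q + 1)                   ≡⟨ solve (q ∷ m ∷ M ∷ []) ⟩
    2 * (m * M * (q + 1))                   ∎
    where open ≤-Reasoning

  4qM²≤excess² : ∀ {q n t M B} → M + M ≡ n + B → 1 ≤ t → q ≤ t * t →
    4 * q * (M * M) ≤ (B * (q + 1) + n * t) * (B * (q + 1) + n * t)
  4qM²≤excess² {q} {n} {t} {M} {B} 2M≡ 1≤t q≤t² = begin
    4 * q * (M * M)                   ≡⟨ solve (q ∷ M ∷ []) ⟩
    q * ((M + M) * (M + M))           ≡⟨ cong (λ z → q * (z * z)) 2M≡ ⟩
    q * ((n + B) * (n + B))           ≡⟨ solve (q ∷ n ∷ B ∷ []) ⟩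
    B * B * q + 2 * B * n * q + n * n * q
      ≤⟨ +-mono-≤ (+-mono-≤ (*-monoʳ-≤ (B * B) q≤[q+1]²) (*-mono-≤ (*-monoʳ-≤ (2 * B) n≤nt) (m≤m+n q 1)))
                  (*-monoʳ-≤ (n * n) q≤t²) ⟩
    B * B * ((q + 1) * (q + 1)) + 2 * B * (n * t) * (q + 1) + n * n * (t * t)
      ≡⟨ solve (q ∷ n ∷ B ∷ t ∷ []) ⟩
    (B * (q + 1) + n * t) * (B * (q + 1) + n * t) ∎
    where
    open ≤-Reasoning
    q≤[q+1]² : q ≤ (q + 1) * (q + 1)
    q≤[q+1]² = ≤-trans (m≤m+n q 1) (m≤m*n (q + 1) (q + 1) {{>-nonZero (subst (0 <_) (+-comm 1 q) (s≤s z≤n))}})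
    n≤nt : n ≤ n * t
    n≤nt = ≤-trans (≤-reflexive (sym (*-identityʳ n))) (*-monoʳ-≤ n 1≤t)

  no-large-gap : ∀ {q n s t m M I X Y} → 1 ≤ q → 2 * s + t ≡ q + 1 → 1 ≤ t → q ≤ t * t →
    n < M + M → I ≤ s * m → m * M ≡ X → Y < X →
    (∀ {D} → n * I + D ≡ X * (q + 1) → D * D ≤ q * X * Y) → ⊥
  no-large-gap {q} {n} {s} {t} {m} {M} {I} {X} {Y} 1≤q 2s+t≡ 1≤t q≤t² n<2M I≤sm mM≡X Y<X deficit =
    <-irrefl refl (begin-strict
      m * m * (4 * q * (M * M))    ≤⟨ *-monoʳ-≤ (m * m) (4qM²≤excess² {q} {n} {t} {M} {B} 2M≡n+B 1≤t q≤t²) ⟩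
      m * m * (R * R)              ≡⟨ square-* m R ⟩
      (m * R) * (m * R)            ≤⟨ *-mono-≤ mR≤2D mR≤2D ⟩
      (2 * D) * (2 * D)            ≡⟨ square-* 2 D ⟨
      2 * 2 * (D * D)              ≡⟨⟩
      4 * (D * D)                  ≤⟨ *-monoʳ-≤ 4 (deficit nI+D≡) ⟩
      4 * (q * X * Y)              ≡⟨ solve (q ∷ X ∷ Y ∷ []) ⟩
      4 * q * X * Y                <⟨ *-monoʳ-< (4 * q * X) {{>-nonZero 4qX>0}} Y<X ⟩
      4 * q * X * X                ≡⟨ cong (λ z → 4 * q * z * z) mM≡X ⟨
      4 * q * (m * M) * (m * M)    ≡⟨ solve (q ∷ m ∷ M ∷ []) ⟩
      m * m * (4 * q * (M * M))    ∎)
    where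
    open ≤-Reasoning
    square-* : ∀ x y → x * x * (y * y) ≡ (x * y) * (x * y)
    square-* = solve-∀
    B = M + M ∸ n
    R = B * (q + 1) + n * t
    2M≡n+B : M + M ≡ n + B
    2M≡n+B = sym (m+[n∸m]≡n (<⇒≤ n<2M))
    excess : 2 * (n * I) + m * R ≤ 2 * (X * (q + 1))
    excess = subst (λ z → 2 * (n * I) + m * R ≤ 2 * (z * (q + 1))) mM≡X
                   (excess≤deficit {q} {n} {s} {t} {m} {M} {B} {I} 2s+t≡ 2M≡n+B I≤sm)
    nI≤X[q+1] : n * I ≤ X * (q + 1)
    nI≤X[q+1] = *-cancelˡ-≤ 2 (≤-trans (m≤m+n (2 * (n * I)) (m * R)) excess)
    D = X * (q + 1) ∸ n * I
    nI+D≡ : n * I + D ≡ X * (q + 1)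
    nI+D≡ = m+[n∸m]≡n nI≤X[q+1]
    mR≤2D : m * R ≤ 2 * D
    mR≤2D = +-cancelˡ-≤ (2 * (n * I)) (m * R) (2 * D)
      (subst (2 * (n * I) + m * R ≤_) (trans (cong (2 *_) (sym nI+D≡)) (*-distribˡ-+ 2 (n * I) D)) excess)
    4qX>0 : 0 < 4 * q * X
    4qX>0 = *-mono-< (*-mono-< (s≤s (z≤n {3})) 1≤q) (≤-trans (s≤s z≤n) Y<X)

  gap²<q : ∀ {q n a a′ b b′ s t I} → 1 ≤ q → 2 * s + t ≡ q + 1 → 1 ≤ t →
    a + a′ ≡ n → b + b′ ≡ n → n < a + b → I ≤ s * a → I ≤ s * b →
    (∀ {D} → n * I + D ≡ a * b * (q + 1) → D * D ≤ q * (a * b) * (a′ * b′)) →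
    t * t < q
  gap²<q {q} {n} {a} {a′} {b} {b′} {s} {t} {I} 1≤q 2s+t≡ 1≤t a+a′≡n b+b′≡n n<a+b I≤sa I≤sb deficit
    with t * t <? q
  ... | yes t²<q = t²<q
  ... | no  t²≮q = [ (λ a≤b → too-large {a} {b} (<-≤-trans n<a+b (+-monoˡ-≤ b a≤b)) I≤sa refl)
                   , (λ b≤a → too-large {b} {a} (<-≤-trans n<a+b (+-monoʳ-≤ a b≤a)) I≤sb (*-comm b a))
                   ]′ (≤-total a b)
    where
    too-large : ∀ {m M} → n < M + M → I ≤ s * m → m * M ≡ a * b → t * t < q
    too-large {m} {M} n<2M I≤sm mM≡ab = ⊥-elim (no-large-gap {q} {n} {s} {t} {m} {M} {I} {a * b} {a′ * b′}
      1≤q 2s+t≡ 1≤t (≮⇒≥ t²≮q) n<2M I≤sm mM≡ab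
      (complement-product {n} {a} {a′} {b} {b′} a+a′≡n b+b′≡n n<a+b) deficit)

  -- When 2 s ≥ q + 1 the truncated subtraction gives 0 and the bound is 0 < q.
  sigma-bound : ∀ {q n a a′ b b′ s I} → 1 ≤ q →
    a + a′ ≡ n → b + b′ ≡ n → n < a + b → I ≤ s * a → I ≤ s * b →
    (∀ {D} → n * I + D ≡ a * b * (q + 1) → D * D ≤ q * (a * b) * (a′ * b′)) →
    (q + 1 ∸ 2 * s) ^ 2 < q
  sigma-bound {q} {n} {a} {a′} {b} {b′} {s} {I} 1≤q a+a′≡n b+b′≡n n<a+b I≤sa I≤sb deficit
    with q + 1 ∸ 2 * s in t≡
  ... | zero  = 1≤q
  ... | suc t = subst (_< q) (cong (suc t *_) (sym (*-identityʳ (suc t))))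
      (gap²<q {q} {n} {a} {a′} {b} {b′} {s} {suc t} {I}
        1≤q 2s+t≡ (s≤s z≤n) a+a′≡n b+b′≡n n<a+b I≤sa I≤sb deficit)
    where
    2s+t≡ : 2 * s + suc t ≡ q + 1
    2s+t≡ = trans (cong (2 * s +_) (sym t≡))
                  (m+[n∸m]≡n {2 * s} (<⇒≤ (m∸n≢0⇒n<m (λ t≡0 → 1+n≢0 (trans (sym t≡) t≡0)))))

module Partition {A B : Set} where

  open import Data.Nat using (suc; _+_)
  open import Data.Nat.Properties using (+-suc)
  open import Data.List.Relation.Unary.All.Properties using (¬Any⇒All¬)
  open import Data.List.Relation.Unary.Unique.Propositional.Properties using (Unique[x∷xs]⇒x∉xs)

  lefts : List (A ⊎ B) → List A
  lefts []           = []
  lefts (inj₁ a ∷ v) = a ∷ lefts v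
  lefts (inj₂ _ ∷ v) = lefts v

  rights : List (A ⊎ B) → List B
  rights []           = []
  rights (inj₁ _ ∷ v) = rights v
  rights (inj₂ b ∷ v) = b ∷ rights v

  length-lefts+rights : ∀ v → length v ≡ length (lefts v) + length (rights v)
  length-lefts+rights []           = refl
  length-lefts+rights (inj₁ _ ∷ v) = cong suc (length-lefts+rights v)
  length-lefts+rights (inj₂ _ ∷ v) = trans (cong suc (length-lefts+rights v)) (sym (+-suc _ _))

  ∈-lefts⁻ : ∀ {a} v → a ∈ lefts v → inj₁ a ∈ v
  ∈-lefts⁻ (inj₁ _ ∷ v) (here refl) = here refl
  ∈-lefts⁻ (inj₁ _ ∷ v) (there a∈)  = there (∈-lefts⁻ v a∈)
  ∈-lefts⁻ (inj₂ _ ∷ v) a∈          = there (∈-lefts⁻ v a∈)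

  ∈-rights⁻ : ∀ {b} v → b ∈ rights v → inj₂ b ∈ v
  ∈-rights⁻ (inj₁ _ ∷ v) b∈          = there (∈-rights⁻ v b∈)
  ∈-rights⁻ (inj₂ _ ∷ v) (here refl) = here refl
  ∈-rights⁻ (inj₂ _ ∷ v) (there b∈)  = there (∈-rights⁻ v b∈)

  lefts-unique : ∀ {v} → Unique v → Unique (lefts v)
  lefts-unique {[]}         _                 = AllPairs.[]
  lefts-unique {inj₁ _ ∷ v} v!@(_ AllPairs.∷ u) =
    ¬Any⇒All¬ _ (Unique[x∷xs]⇒x∉xs v! ∘′ ∈-lefts⁻ v) AllPairs.∷ lefts-unique u
  lefts-unique {inj₂ _ ∷ v} (_ AllPairs.∷ u)  = lefts-unique u

  rights-unique : ∀ {v} → Unique v → Unique (rights v)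
  rights-unique {[]}         _                 = AllPairs.[]
  rights-unique {inj₁ _ ∷ v} (_ AllPairs.∷ u)  = rights-unique u
  rights-unique {inj₂ _ ∷ v} v!@(_ AllPairs.∷ u) =
    ¬Any⇒All¬ _ (Unique[x∷xs]⇒x∉xs v! ∘′ ∈-rights⁻ v) AllPairs.∷ rights-unique u

module Degrees (G : Graph) where

  open import Data.Nat using (_≤_; _⊔_)
  open import Data.Nat.Properties using (m≤m⊔n; m≤n⇒m≤o⊔n)

  degree≤maxDegree : ∀ K {v} → v ∈ K → degreeIn G K v ≤ maxDegreeIn G K
  degree≤maxDegree K = ≤-foldr-⊔ K
    where
    ≤-foldr-⊔ : ∀ vs {v} → v ∈ vs → degreeIn G K v ≤ foldr (λ u m → degreeIn G K u ⊔ m) 0 vs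
    ≤-foldr-⊔ (u ∷ vs) (here refl) = m≤m⊔n (degreeIn G K u) _
    ≤-foldr-⊔ (u ∷ vs) (there v∈)  = m≤n⇒m≤o⊔n (degreeIn G K u) (≤-foldr-⊔ vs v∈)

module Plane (F : FiniteField) where

  open import Level using (0ℓ)
  open import Algebra.Bundles using (CommutativeRing)
  open import Algebra.Structures using (IsCommutativeRing)
  open import Data.Fin using (Fin; zero; suc)
  open FiniteField F
  open IsCommutativeRing isCommutativeRing using
    ( +-assoc; +-comm; *-assoc; *-comm; +-identityˡ; +-identityʳ; *-identityˡ; *-identityʳ
    ; zeroˡ; zeroʳ; -‿inverseˡ; -‿inverseʳ)

  commutativeRing : CommutativeRing 0ℓ 0ℓ
  commutativeRing = record { isCommutativeRing = isCommutativeRing }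

  open CommutativeRing commutativeRing using (_-_)

  open import Algebra.Properties.Ring (CommutativeRing.ring commutativeRing)
    using (+-cancelˡ; +-cancelʳ; x∙y⁻¹≈ε⇒x≈y; -‿distribˡ-*; x[y-z]≈xy-xz)
  open import Algebra.Solver.Ring.NaturalCoefficients.Default
    (CommutativeRing.commutativeSemiring commutativeRing) using (solve; _:=_; _:+_; _:*_)

  1≢0 : 1# ≢ 0#
  1≢0 = 0≢1 ∘ sym

  *-cancelˡ : ∀ {x y z} → x ≢ 0# → x * y ≡ x * z → y ≡ z
  *-cancelˡ {x} {y} {z} x≢0 xy≡xz with inverse x x≢0
  ... | x⁻¹ , xx⁻¹≡1 = begin
    y               ≡⟨ *-identityˡ y ⟨
    1# * y          ≡⟨ cong (_* y) x⁻¹x≡1 ⟨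
    x⁻¹ * x * y     ≡⟨ *-assoc x⁻¹ x y ⟩
    x⁻¹ * (x * y)   ≡⟨ cong (x⁻¹ *_) xy≡xz ⟩
    x⁻¹ * (x * z)   ≡⟨ *-assoc x⁻¹ x z ⟨
    x⁻¹ * x * z     ≡⟨ cong (_* z) x⁻¹x≡1 ⟩
    1# * z          ≡⟨ *-identityˡ z ⟩
    z               ∎
    where
    open ≡-Reasoning
    x⁻¹x≡1 : x⁻¹ * x ≡ 1#
    x⁻¹x≡1 = trans (*-comm x⁻¹ x) xx⁻¹≡1

  [x-y]+[y+w]≡x+w : ∀ x y w → (x - y) + (y + w) ≡ x + w
  [x-y]+[y+w]≡x+w x y w = begin
    (x + - y) + (y + w)   ≡⟨ +-assoc x (- y) (y + w) ⟩
    x + (- y + (y + w))   ≡⟨ cong (x +_) (+-assoc (- y) y w) ⟨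
    x + ((- y + y) + w)   ≡⟨ cong (λ e → x + (e + w)) (-‿inverseˡ y) ⟩
    x + (0# + w)          ≡⟨ cong (x +_) (+-identityˡ w) ⟩
    x + w                 ∎
    where open ≡-Reasoning

  x-y≡z-w : ∀ {x y z w} → x + w ≡ z + y → x - y ≡ z - w
  x-y≡z-w {x} {y} {z} {w} x+w≡z+y = +-cancelʳ (y + w) (x - y) (z - w) (begin
    (x - y) + (y + w)   ≡⟨ [x-y]+[y+w]≡x+w x y w ⟩
    x + w               ≡⟨ x+w≡z+y ⟩
    z + y               ≡⟨ [x-y]+[y+w]≡x+w z w y ⟨
    (z - w) + (w + y)   ≡⟨ cong ((z - w) +_) (+-comm w y) ⟩
    (z - w) + (y + w)   ∎)
    where open ≡-Reasoning

  cross-multiply : ∀ {a b x y z w} → a * x + b * w ≡ b * z + a * y → a * (x - y) ≡ b * (z - w)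
  cross-multiply {a} {b} {x} {y} {z} {w} eq =
    trans (x[y-z]≈xy-xz a x y) (trans (x-y≡z-w eq) (sym (x[y-z]≈xy-xz b z w)))

  affine : Carrier → Carrier → Carrier → Carrier
  affine α β x = α + x * β

  affine-injective : ∀ {α β x y} → β ≢ 0# → affine α β x ≡ affine α β y → x ≡ y
  affine-injective {α} {β} {x} {y} β≢0 eq =
    *-cancelˡ β≢0 (trans (*-comm β x) (trans (+-cancelˡ α (x * β) (y * β) eq) (*-comm y β)))

  affine-constant : ∀ α x → affine α 0# x ≡ α
  affine-constant α x = trans (cong (α +_) (zeroʳ x)) (+-identityʳ α)

  affine-root : ∀ α {β} → β ≢ 0# → ∃[ x ] affine α β x ≡ 0#
  affine-root α {β} β≢0 with inverse β β≢0
  ... | β⁻¹ , ββ⁻¹≡1 = - (α * β⁻¹) , (begin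
    α + - (α * β⁻¹) * β    ≡⟨ cong (α +_) (-‿distribˡ-* (α * β⁻¹) β) ⟨
    α + - (α * β⁻¹ * β)    ≡⟨ cong (λ e → α + - e) (*-assoc α β⁻¹ β) ⟩
    α + - (α * (β⁻¹ * β))  ≡⟨ cong (λ e → α + - (α * e)) (trans (*-comm β⁻¹ β) ββ⁻¹≡1) ⟩
    α + - (α * 1#)         ≡⟨ cong (λ e → α + - e) (*-identityʳ α) ⟩
    α + - α                ≡⟨ -‿inverseʳ α ⟩
    0#                     ∎)
    where open ≡-Reasoning

  F³ : Set
  F³ = Carrier × Carrier × Carrier

  coord : Fin 3 → F³ → Carrier
  coord zero             (x , _ , _) = x
  coord (suc zero)       (_ , y , _) = y
  coord (suc (suc zero)) (_ , _ , z) = z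

  Parallel : F³ → F³ → Set
  Parallel u v = ∀ i j → coord i u * coord j v ≡ coord j u * coord i v

  parallel-from-minors : ∀ {u₁ u₂ u₃ v₁ v₂ v₃} →
    u₁ * v₂ ≡ u₂ * v₁ → u₁ * v₃ ≡ u₃ * v₁ → u₂ * v₃ ≡ u₃ * v₂ → Parallel (u₁ , u₂ , u₃) (v₁ , v₂ , v₃)
  parallel-from-minors m₁₂ m₁₃ m₂₃ zero             zero             = refl
  parallel-from-minors m₁₂ m₁₃ m₂₃ zero             (suc zero)       = m₁₂
  parallel-from-minors m₁₂ m₁₃ m₂₃ zero             (suc (suc zero)) = m₁₃
  parallel-from-minors m₁₂ m₁₃ m₂₃ (suc zero)       zero             = sym m₁₂
  parallel-from-minors m₁₂ m₁₃ m₂₃ (suc zero)       (suc zero)       = refl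
  parallel-from-minors m₁₂ m₁₃ m₂₃ (suc zero)       (suc (suc zero)) = m₂₃
  parallel-from-minors m₁₂ m₁₃ m₂₃ (suc (suc zero)) zero             = sym m₁₃
  parallel-from-minors m₁₂ m₁₃ m₂₃ (suc (suc zero)) (suc zero)       = sym m₂₃
  parallel-from-minors m₁₂ m₁₃ m₂₃ (suc (suc zero)) (suc (suc zero)) = refl

  parallel-trans : ∀ {u v c} k → coord k c ≢ 0# → Parallel u c → Parallel v c → Parallel u v
  parallel-trans {u} {v} {c} k cₖ≢0 u∥c v∥c i j = *-cancelˡ cₖ≢0 (*-cancelˡ cₖ≢0 (begin
    cₖ * (cₖ * (uᵢ * vⱼ))   ≡⟨ spread cₖ uᵢ vⱼ ⟩
    (uᵢ * cₖ) * (vⱼ * cₖ)   ≡⟨ cong₂ _*_ (u∥c i k) (v∥c j k) ⟩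
    (uₖ * cᵢ) * (vₖ * cⱼ)   ≡⟨ swap uₖ cᵢ vₖ cⱼ ⟩
    (uₖ * cⱼ) * (vₖ * cᵢ)   ≡⟨ cong₂ _*_ (u∥c j k) (v∥c i k) ⟨
    (uⱼ * cₖ) * (vᵢ * cₖ)   ≡⟨ spread cₖ uⱼ vᵢ ⟨
    cₖ * (cₖ * (uⱼ * vᵢ))   ∎))
    where
    open ≡-Reasoning
    cₖ = coord k c ; cᵢ = coord i c ; cⱼ = coord j c
    uₖ = coord k u ; uᵢ = coord i u ; uⱼ = coord j u
    vₖ = coord k v ; vᵢ = coord i v ; vⱼ = coord j v
    spread : ∀ c x y → c * (c * (x * y)) ≡ (x * c) * (y * c)
    spread = solve 3 (λ c x y → c :* (c :* (x :* y)) := (x :* c) :* (y :* c)) refl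
    swap : ∀ a b c d → (a * b) * (c * d) ≡ (a * d) * (c * b)
    swap = solve 4 (λ a b c d → (a :* b) :* (c :* d) := (a :* d) :* (c :* b)) refl

  infixl 7 _⨯_
  _⨯_ : F³ → F³ → F³
  (u₁ , u₂ , u₃) ⨯ (v₁ , v₂ , v₃) = (u₂ * v₃ - u₃ * v₂) , (u₃ * v₁ - u₁ * v₃) , (u₁ * v₂ - u₂ * v₁)

  orthogonal⇒parallel-⨯ : ∀ w u v → dot F w u ≡ 0# → dot F w v ≡ 0# → Parallel w (u ⨯ v)
  orthogonal⇒parallel-⨯ (w₁ , w₂ , w₃) (u₁ , u₂ , u₃) (v₁ , v₂ , v₃) w·u≡0 w·v≡0 =
    parallel-from-minors
      (cross-multiply (drop-dots w·u≡0 w·v≡0 (lagrange₁₂ w₁ w₂ w₃ u₁ u₂ u₃ v₁ v₂ v₃)))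
      (cross-multiply (drop-dots w·v≡0 w·u≡0 (lagrange₁₃ w₁ w₂ w₃ u₁ u₂ u₃ v₁ v₂ v₃)))
      (cross-multiply (drop-dots w·u≡0 w·v≡0 (lagrange₂₃ w₁ w₂ w₃ u₁ u₂ u₃ v₁ v₂ v₃)))
    where
    drop-dots : ∀ {x y a b d d′} → d ≡ 0# → d′ ≡ 0# → x + a * d ≡ y + b * d′ → x ≡ y
    drop-dots {x} {y} {a} {b} refl refl eq =
      trans (sym (trans (cong (x +_) (zeroʳ a)) (+-identityʳ x)))
            (trans eq (trans (cong (y +_) (zeroʳ b)) (+-identityʳ y)))
    -- the coordinates of w ⨯ (u ⨯ v) = (w·v) u − (w·u) v, with the negative terms moved across
    lagrange₁₂ : ∀ w₁ w₂ w₃ u₁ u₂ u₃ v₁ v₂ v₃ →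
      w₁ * (u₃ * v₁) + w₂ * (u₃ * v₂) + v₃ * (w₁ * u₁ + w₂ * u₂ + w₃ * u₃)
        ≡ w₂ * (u₂ * v₃) + w₁ * (u₁ * v₃) + u₃ * (w₁ * v₁ + w₂ * v₂ + w₃ * v₃)
    lagrange₁₂ = solve 9 (λ w₁ w₂ w₃ u₁ u₂ u₃ v₁ v₂ v₃ →
      w₁ :* (u₃ :* v₁) :+ w₂ :* (u₃ :* v₂) :+ v₃ :* (w₁ :* u₁ :+ w₂ :* u₂ :+ w₃ :* u₃)
        := w₂ :* (u₂ :* v₃) :+ w₁ :* (u₁ :* v₃) :+ u₃ :* (w₁ :* v₁ :+ w₂ :* v₂ :+ w₃ :* v₃)) refl
    lagrange₁₃ : ∀ w₁ w₂ w₃ u₁ u₂ u₃ v₁ v₂ v₃ →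
      w₁ * (u₁ * v₂) + w₃ * (u₃ * v₂) + u₂ * (w₁ * v₁ + w₂ * v₂ + w₃ * v₃)
        ≡ w₃ * (u₂ * v₃) + w₁ * (u₂ * v₁) + v₂ * (w₁ * u₁ + w₂ * u₂ + w₃ * u₃)
    lagrange₁₃ = solve 9 (λ w₁ w₂ w₃ u₁ u₂ u₃ v₁ v₂ v₃ →
      w₁ :* (u₁ :* v₂) :+ w₃ :* (u₃ :* v₂) :+ u₂ :* (w₁ :* v₁ :+ w₂ :* v₂ :+ w₃ :* v₃)
        := w₃ :* (u₂ :* v₃) :+ w₁ :* (u₂ :* v₁) :+ v₂ :* (w₁ :* u₁ :+ w₂ :* u₂ :+ w₃ :* u₃)) refl
    lagrange₂₃ : ∀ w₁ w₂ w₃ u₁ u₂ u₃ v₁ v₂ v₃ →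
      w₂ * (u₁ * v₂) + w₃ * (u₁ * v₃) + v₁ * (w₁ * u₁ + w₂ * u₂ + w₃ * u₃)
        ≡ w₃ * (u₃ * v₁) + w₂ * (u₂ * v₁) + u₁ * (w₁ * v₁ + w₂ * v₂ + w₃ * v₃)
    lagrange₂₃ = solve 9 (λ w₁ w₂ w₃ u₁ u₂ u₃ v₁ v₂ v₃ →
      w₂ :* (u₁ :* v₂) :+ w₃ :* (u₁ :* v₃) :+ v₁ :* (w₁ :* u₁ :+ w₂ :* u₂ :+ w₃ :* u₃)
        := w₃ :* (u₃ :* v₁) :+ w₂ :* (u₂ :* v₁) :+ u₁ :* (w₁ :* v₁ :+ w₂ :* v₂ :+ w₃ :* v₃)) refl

  1*x≡y*1⇒y≡x : ∀ {x y} → 1# * x ≡ y * 1# → y ≡ x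
  1*x≡y*1⇒y≡x {x} {y} eq = sym (trans (sym (*-identityˡ x)) (trans eq (*-identityʳ y)))

  1*1≢x*0 : ∀ {x} → 1# * 1# ≢ x * 0#
  1*1≢x*0 {x} eq = 1≢0 (trans (sym (*-identityˡ 1#)) (trans eq (zeroʳ x)))

  0*x≢1*1 : ∀ {x} → 0# * x ≢ 1# * 1#
  0*x≢1*1 {x} eq = 1*1≢x*0 (trans (sym eq) (*-comm 0# x))

  parallel-coords⇒≡ : ∀ p p′ → Parallel (coords F p) (coords F p′) → p ≡ p′
  parallel-coords⇒≡ (pt₁ a b) (pt₁ a′ b′) ∥ =
    cong₂ pt₁ (1*x≡y*1⇒y≡x (∥ zero (suc zero))) (1*x≡y*1⇒y≡x (∥ zero (suc (suc zero))))
  parallel-coords⇒≡ (pt₁ a b) (pt₂ a′)    ∥ = contradiction (∥ zero (suc zero)) 1*1≢x*0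
  parallel-coords⇒≡ (pt₁ a b) pt₃         ∥ = contradiction (∥ zero (suc (suc zero))) 1*1≢x*0
  parallel-coords⇒≡ (pt₂ a)   (pt₁ a′ b′) ∥ = contradiction (∥ zero (suc zero)) 0*x≢1*1
  parallel-coords⇒≡ (pt₂ a)   (pt₂ a′)    ∥ = cong pt₂ (1*x≡y*1⇒y≡x (∥ (suc zero) (suc (suc zero))))
  parallel-coords⇒≡ (pt₂ a)   pt₃         ∥ = contradiction (∥ (suc zero) (suc (suc zero))) 1*1≢x*0
  parallel-coords⇒≡ pt₃       (pt₁ a′ b′) ∥ = contradiction (∥ zero (suc (suc zero))) 0*x≢1*1
  parallel-coords⇒≡ pt₃       (pt₂ a′)    ∥ = contradiction (∥ (suc zero) (suc (suc zero))) 0*x≢1*1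
  parallel-coords⇒≡ pt₃       pt₃         ∥ = refl

  coords-nonzero : ∀ p → coords F p ≢ (0# , 0# , 0#)
  coords-nonzero (pt₁ _ _) eq = 1≢0 (cong proj₁ eq)
  coords-nonzero (pt₂ _)   eq = 1≢0 (cong (proj₁ ∘ proj₂) eq)
  coords-nonzero pt₃       eq = 1≢0 (cong (proj₂ ∘ proj₂) eq)

  distinct⇒⨯-nonzero : ∀ {p p′} → p ≢ p′ → ∃[ k ] coord k (coords F p ⨯ coords F p′) ≢ 0#
  distinct⇒⨯-nonzero {p} {p′} p≢p′
    with coords F p in p≡ | coords F p′ in p′≡
  ... | (u₁ , u₂ , u₃) | (v₁ , v₂ , v₃)
    with (u₂ * v₃ - u₃ * v₂) ≟ 0# | (u₃ * v₁ - u₁ * v₃) ≟ 0# | (u₁ * v₂ - u₂ * v₁) ≟ 0#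
  ... | no  c₁≢0 | _        | _        = zero , c₁≢0
  ... | yes _    | no c₂≢0  | _        = suc zero , c₂≢0
  ... | yes _    | yes _    | no c₃≢0  = suc (suc zero) , c₃≢0
  ... | yes c₁≡0 | yes c₂≡0 | yes c₃≡0 = contradiction (parallel-coords⇒≡ p p′ p∥p′) p≢p′
    where
    p∥p′ : Parallel (coords F p) (coords F p′)
    p∥p′ rewrite p≡ | p′≡ = parallel-from-minors
      (x∙y⁻¹≈ε⇒x≈y _ _ c₃≡0) (sym (x∙y⁻¹≈ε⇒x≈y _ _ c₂≡0)) (x∙y⁻¹≈ε⇒x≈y _ _ c₁≡0)

  two-lines-meet-once : ∀ {l l′ x y} → l ≢ l′ →
    Incident F x l → Incident F x l′ → Incident F y l → Incident F y l′ → x ≡ y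
  two-lines-meet-once {l} {l′} {x} {y} l≢l′ x∈l x∈l′ y∈l y∈l′ with distinct⇒⨯-nonzero l≢l′
  ... | k , cₖ≢0 = parallel-coords⇒≡ x y (parallel-trans k cₖ≢0
    (orthogonal⇒parallel-⨯ (coords F x) (coords F l) (coords F l′) x∈l x∈l′)
    (orthogonal⇒parallel-⨯ (coords F y) (coords F l) (coords F l′) y∈l y∈l′))

  _≟ₚ_ : DecidableEquality (Proj F)
  pt₁ a b ≟ₚ pt₁ a′ b′ with a ≟ a′ | b ≟ b′
  ... | yes refl | yes refl = yes refl
  ... | no a≢a′  | _        = no λ { refl → a≢a′ refl }
  ... | yes _    | no b≢b′  = no λ { refl → b≢b′ refl }
  pt₁ _ _ ≟ₚ pt₂ _ = no λ ()
  pt₁ _ _ ≟ₚ pt₃   = no λ ()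
  pt₂ _ ≟ₚ pt₁ _ _ = no λ ()
  pt₂ a ≟ₚ pt₂ a′ with a ≟ a′
  ... | yes refl = yes refl
  ... | no a≢a′  = no λ { refl → a≢a′ refl }
  pt₂ _ ≟ₚ pt₃   = no λ ()
  pt₃ ≟ₚ pt₁ _ _ = no λ ()
  pt₃ ≟ₚ pt₂ _   = no λ ()
  pt₃ ≟ₚ pt₃     = yes refl

  incident? : ∀ p l → Dec (Incident F p l)
  incident? p l = dot F (coords F p) (coords F l) ≟ 0#

  dot-pt₁ : ∀ a b l₁ l₂ l₃ → dot F (coords F (pt₁ a b)) (l₁ , l₂ , l₃) ≡ affine (affine l₁ l₂ a) l₃ b
  dot-pt₁ a b l₁ l₂ l₃ = cong (λ e → e + a * l₂ + b * l₃) (*-identityˡ l₁)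

  dot-pt₂ : ∀ a l₁ l₂ l₃ → dot F (coords F (pt₂ a)) (l₁ , l₂ , l₃) ≡ affine l₂ l₃ a
  dot-pt₂ a l₁ l₂ l₃ = cong (_+ a * l₃)
    (trans (cong₂ _+_ (zeroˡ l₁) (*-identityˡ l₂)) (+-identityˡ l₂))

  dot-pt₃ : ∀ l₁ l₂ l₃ → dot F (coords F pt₃) (l₁ , l₂ , l₃) ≡ l₃
  dot-pt₃ l₁ l₂ l₃ = trans
    (cong₂ _+_ (trans (cong₂ _+_ (zeroˡ l₁) (zeroˡ l₂)) (+-identityˡ 0#)) (*-identityˡ l₃))
    (+-identityˡ l₃)

module PlaneCounts (F : FiniteField) where

  open import Data.Nat using (ℕ; _+_; _*_; _∸_; _≤_; z≤n; s≤s)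
  open import Data.Nat.Properties hiding (_≟_)
  open import Data.List.Membership.Propositional.Properties
    using (∈-++⁺ˡ; ∈-++⁺ʳ; ∈-++⁻; ∈-map⁺; ∈-map⁻; ∈-cartesianProductWith⁺; ∈-cartesianProductWith⁻)
  open import Data.List.Relation.Unary.Unique.Propositional.Properties
    using (++⁺; map⁺; cartesianProductWith⁺)
  open import Data.List.Relation.Binary.Disjoint.Propositional using (Disjoint)
  open FiniteField F using (Carrier; 0#; 1#; _≟_; elements; elements-unique; elements-complete; order)
  open Summation
  open Arithmetic using (deficit-bound)
  open Plane F

  q : ℕ
  q = order

  1≤q : 1 ≤ q
  1≤q with elements | elements-complete 0#
  ... | _ ∷ _ | _ = s≤s z≤n

  module Elements = Enumeration _≟_ elements elements-unique elements-complete

  #roots : Carrier → Carrier → ℕ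
  #roots α β = ∑[ x ∈ elements ] 𝟙 (affine α β x ≟ 0#)

  #roots-nonconstant : ∀ α {β} → β ≢ 0# → #roots α β ≡ 1
  #roots-nonconstant α {β} β≢0 with affine-root α β≢0
  ... | x₀ , x₀-root = Elements.∑𝟙-unique (λ x → affine α β x ≟ 0#) (mk⇔
    (λ x-root → affine-injective β≢0 (trans x-root (sym x₀-root)))
    (λ { refl → x₀-root }))

  #roots-constant : ∀ α → #roots α 0# ≡ 𝟙 (α ≟ 0#) * q
  #roots-constant α = trans (∑-cong elements (λ x → cong (λ e → 𝟙 (e ≟ 0#)) (affine-constant α x)))
                            (∑-const elements (𝟙 (α ≟ 0#)))

  allProj : List (Proj F)
  allProj = cartesianProductWith pt₁ elements elements ++ map pt₂ elements ++ pt₃ ∷ []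

  allProj-unique : Unique allProj
  allProj-unique =
    ++⁺ (cartesianProductWith⁺ pt₁ pt₁-injective elements-unique elements-unique)
        (++⁺ (map⁺ pt₂-injective elements-unique) (All.[] AllPairs.∷ AllPairs.[]) pt₂-pt₃-disjoint)
        pt₁-disjoint
    where
    pt₁-injective : ∀ {a a′ b b′} → pt₁ a b ≡ pt₁ a′ b′ → a ≡ a′ × b ≡ b′
    pt₁-injective refl = refl , refl
    pt₂-injective : ∀ {a a′} → pt₂ a ≡ pt₂ a′ → a ≡ a′
    pt₂-injective refl = refl
    pt₂-pt₃-disjoint : Disjoint (map pt₂ elements) (pt₃ ∷ [])
    pt₂-pt₃-disjoint (v∈pt₂s , here refl) with ∈-map⁻ pt₂ v∈pt₂s
    ... | _ , _ , ()
    pt₁-disjoint : Disjoint (cartesianProductWith pt₁ elements elements) (map pt₂ elements ++ pt₃ ∷ [])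
    pt₁-disjoint (v∈pt₁s , v∈rest) with ∈-cartesianProductWith⁻ pt₁ elements elements v∈pt₁s
    ... | _ , _ , _ , _ , refl with ∈-++⁻ (map pt₂ elements) v∈rest
    ...   | inj₁ v∈pt₂s with ∈-map⁻ pt₂ v∈pt₂s
    ...     | _ , _ , ()
    pt₁-disjoint _ | _ , _ , _ , _ , refl | inj₂ (here ())

  ∈-allProj : ∀ p → p ∈ allProj
  ∈-allProj (pt₁ a b) = ∈-++⁺ˡ (∈-cartesianProductWith⁺ pt₁ (elements-complete a) (elements-complete b))
  ∈-allProj (pt₂ a)   = ∈-++⁺ʳ (cartesianProductWith pt₁ elements elements)
                          (∈-++⁺ˡ (∈-map⁺ pt₂ (elements-complete a)))
  ∈-allProj pt₃       = ∈-++⁺ʳ (cartesianProductWith pt₁ elements elements)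
                          (∈-++⁺ʳ (map pt₂ elements) (here refl))

  module Projs = Enumeration _≟ₚ_ allProj allProj-unique ∈-allProj

  ∑-allProj : ∀ f → ∑ allProj f ≡
    (∑[ a ∈ elements ] ∑[ b ∈ elements ] f (pt₁ a b)) + ((∑[ a ∈ elements ] f (pt₂ a)) + (f pt₃ + 0))
  ∑-allProj f = trans (∑-++ (cartesianProductWith pt₁ elements elements) _ f)
    (cong₂ _+_ (∑-cartesianProductWith pt₁ elements elements f)
               (trans (∑-++ (map pt₂ elements) _ f) (cong (_+ (f pt₃ + 0)) (∑-map pt₂ elements f))))

  length-allProj : length allProj ≡ q * q + q + 1
  length-allProj = begin
    length allProj                                        ≡⟨ ∑-length allProj ⟨
    ∑ allProj (λ _ → 1)                                   ≡⟨ ∑-allProj (λ _ → 1) ⟩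
    (∑[ a ∈ elements ] ∑ elements (λ _ → 1)) + (∑ elements (λ _ → 1) + 1)
      ≡⟨ cong₂ (λ m k → m + (k + 1)) (trans (∑-cong elements (λ _ → ∑-length elements))
                                            (∑-const elements q)) (∑-length elements) ⟩
    q * q + (q + 1)                                       ≡⟨ +-assoc (q * q) q 1 ⟨
    q * q + q + 1                                         ∎
    where open ≡-Reasoning

  roots-total-degenerate : ∀ l₁ l₂ → (l₁ , l₂ , 0#) ≢ (0# , 0# , 0#) →
    #roots l₁ l₂ * q + (𝟙 (l₂ ≟ 0#) * q + 1) ≡ q + 1
  roots-total-degenerate l₁ l₂ l≢0 with l₂ ≟ 0#
  ... | no l₂≢0 = trans (cong (λ m → m * q + 1) (#roots-nonconstant l₁ l₂≢0)) (cong (_+ 1) (*-identityˡ q))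
  ... | yes refl = trans (cong (λ m → m * q + (1 * q + 1)) (trans (#roots-constant l₁)
                     (cong (_* q) (𝟙-no (l₁ ≟ 0#) λ { refl → l≢0 refl }))))
                     (cong (_+ 1) (*-identityˡ q))

  roots-total : ∀ l₁ l₂ l₃ → (l₁ , l₂ , l₃) ≢ (0# , 0# , 0#) →
    (∑[ a ∈ elements ] #roots (affine l₁ l₂ a) l₃) + (#roots l₂ l₃ + (𝟙 (l₃ ≟ 0#) + 0)) ≡ q + 1
  roots-total l₁ l₂ l₃ l≢0 with l₃ ≟ 0#
  ... | no l₃≢0 = cong₂ _+_
          (trans (∑-cong elements (λ a → #roots-nonconstant (affine l₁ l₂ a) l₃≢0)) (∑-length elements))
          (trans (+-identityʳ (#roots l₂ l₃)) (#roots-nonconstant l₂ l₃≢0))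
  ... | yes refl = begin
    (∑[ a ∈ elements ] #roots (affine l₁ l₂ a) 0#) + (#roots l₂ 0# + 1)
      ≡⟨ cong₂ _+_ (∑-cong elements (λ a → #roots-constant (affine l₁ l₂ a)))
                   (cong (_+ 1) (#roots-constant l₂)) ⟩
    (∑[ a ∈ elements ] 𝟙 (affine l₁ l₂ a ≟ 0#) * q) + (𝟙 (l₂ ≟ 0#) * q + 1)
      ≡⟨ cong (_+ (𝟙 (l₂ ≟ 0#) * q + 1)) (*-distribʳ-∑ elements q (λ a → 𝟙 (affine l₁ l₂ a ≟ 0#))) ⟩
    #roots l₁ l₂ * q + (𝟙 (l₂ ≟ 0#) * q + 1)
      ≡⟨ roots-total-degenerate l₁ l₂ l≢0 ⟩
    q + 1 ∎
    where open ≡-Reasoning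

  points-on-plane : ∀ l₁ l₂ l₃ → (l₁ , l₂ , l₃) ≢ (0# , 0# , 0#) →
    ∑[ x ∈ allProj ] 𝟙 (dot F (coords F x) (l₁ , l₂ , l₃) ≟ 0#) ≡ q + 1
  points-on-plane l₁ l₂ l₃ l≢0 = trans (∑-allProj _) (trans
    (cong₂ _+_ (∑-cong elements λ a → ∑-cong elements λ b → 𝟙≟0-cong (dot-pt₁ a b l₁ l₂ l₃))
               (cong₂ _+_ (∑-cong elements λ a → 𝟙≟0-cong (dot-pt₂ a l₁ l₂ l₃))
                          (cong (_+ 0) (𝟙≟0-cong (dot-pt₃ l₁ l₂ l₃)))))
    (roots-total l₁ l₂ l₃ l≢0))
    where
    𝟙≟0-cong : ∀ {x y} → x ≡ y → 𝟙 (x ≟ 0#) ≡ 𝟙 (y ≟ 0#)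
    𝟙≟0-cong = cong (λ e → 𝟙 (e ≟ 0#))

  points-on-line : ∀ l → ∑[ x ∈ allProj ] 𝟙 (incident? x l) ≡ q + 1
  points-on-line l@(pt₁ u v) = points-on-plane 1# u v (coords-nonzero l)
  points-on-line l@(pt₂ u)   = points-on-plane 0# 1# u (coords-nonzero l)
  points-on-line l@pt₃       = points-on-plane 0# 0# 1# (coords-nonzero l)

  common-points : Proj F → Proj F → ℕ
  common-points l l′ = ∑[ x ∈ allProj ] 𝟙 (incident? x l) * 𝟙 (incident? x l′)

  common-points≤ : ∀ l l′ → common-points l l′ ≤ 𝟙 (l ≟ₚ l′) * q + 1
  common-points≤ l l′ with l ≟ₚ l′
  ... | yes refl = ≤-reflexive (trans (∑-cong allProj (λ x → 𝟙-idem (incident? x l)))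
                     (trans (points-on-line l) (cong (_+ 1) (sym (*-identityˡ q)))))
  ... | no l≢l′ = ≤-trans (≤-reflexive (∑-cong allProj λ x → sym (𝟙-× (incident? x l) (incident? x l′))))
                    (∑𝟙≤1 (λ x → incident? x l ×-dec incident? x l′) allProj-unique
                      λ (x∈l , x∈l′) (y∈l , y∈l′) → two-lines-meet-once l≢l′ x∈l x∈l′ y∈l y∈l′)

  module Incidences {P L : List (Proj F)} (P! : Unique P) (L! : Unique L) where

    lines-through : Proj F → ℕ
    lines-through x = ∑[ l ∈ L ] 𝟙 (incident? x l)

    incidences : ℕ
    incidences = ∑ P lines-through

    ∑-lines-through : ∑ allProj lines-through ≡ length L * (q + 1)
    ∑-lines-through = begin
      ∑[ x ∈ allProj ] ∑[ l ∈ L ] 𝟙 (incident? x l)  ≡⟨ ∑-comm allProj L (λ x l → 𝟙 (incident? x l)) ⟩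
      ∑[ l ∈ L ] ∑[ x ∈ allProj ] 𝟙 (incident? x l)  ≡⟨ ∑-cong L points-on-line ⟩
      ∑ L (λ _ → q + 1)                              ≡⟨ ∑-const L (q + 1) ⟩
      (q + 1) * length L                             ≡⟨ *-comm (q + 1) (length L) ⟩
      length L * (q + 1)                             ∎
      where open ≡-Reasoning

    ∑-lines-through² : ∑[ x ∈ allProj ] lines-through x * lines-through x ≤ length L * (q + length L)
    ∑-lines-through² = begin
      ∑[ x ∈ allProj ] lines-through x * lines-through x
        ≡⟨ ∑-cong allProj square≡∑∑ ⟩
      ∑[ x ∈ allProj ] ∑[ l ∈ L ] ∑[ l′ ∈ L ] 𝟙 (incident? x l) * 𝟙 (incident? x l′)
        ≡⟨ ∑-comm allProj L _ ⟩
      ∑[ l ∈ L ] ∑[ x ∈ allProj ] ∑[ l′ ∈ L ] 𝟙 (incident? x l) * 𝟙 (incident? x l′)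
        ≡⟨ ∑-cong L (λ l → ∑-comm allProj L _) ⟩
      ∑[ l ∈ L ] ∑[ l′ ∈ L ] common-points l l′
        ≤⟨ ∑-mono-≤ L (λ l → ∑-mono-≤ L (common-points≤ l)) ⟩
      ∑[ l ∈ L ] ∑[ l′ ∈ L ] (𝟙 (l ≟ₚ l′) * q + 1)
        ≡⟨ ∑-cong L (λ l → trans (∑-distrib-+ L _ _)
             (cong₂ _+_ (*-distribʳ-∑ L q (λ l′ → 𝟙 (l ≟ₚ l′))) (∑-length L))) ⟩
      ∑[ l ∈ L ] (multiplicity _≟ₚ_ L l * q + length L)
        ≤⟨ ∑-mono-≤ L (λ l → +-monoˡ-≤ (length L)
             (≤-trans (*-monoˡ-≤ q (multiplicity≤1 _≟ₚ_ L! l)) (≤-reflexive (*-identityˡ q)))) ⟩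
      ∑ L (λ _ → q + length L)
        ≡⟨ ∑-const L (q + length L) ⟩
      (q + length L) * length L
        ≡⟨ *-comm (q + length L) (length L) ⟩
      length L * (q + length L) ∎
      where
      open ≤-Reasoning
      square≡∑∑ : ∀ x → lines-through x * lines-through x ≡
                        ∑[ l ∈ L ] ∑[ l′ ∈ L ] 𝟙 (incident? x l) * 𝟙 (incident? x l′)
      square≡∑∑ x = trans (sym (*-distribʳ-∑ L (lines-through x) (λ l → 𝟙 (incident? x l))))
                      (∑-cong L (λ l → sym (*-distribˡ-∑ L (𝟙 (incident? x l)) (λ l′ → 𝟙 (incident? x l′)))))

    deficit : ∀ {D} → length allProj * incidences + D ≡ length P * length L * (q + 1) →
      D * D ≤ q * (length P * length L) * (Projs.outside P * Projs.outside L)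
    deficit = deficit-bound {q} {length allProj} {length P} {Projs.outside P} {length L} {Projs.outside L}
      length-allProj (Projs.length+outside P!) (Projs.length+outside L!) I+J≡ S+S′≤ I²≤ J²≤
      where
      w : Proj F → ℕ
      w = multiplicity _≟ₚ_ P
      w≤1 : ∀ x → w x ≤ 1
      w≤1 = multiplicity≤1 _≟ₚ_ P!
      J = ∑[ x ∈ allProj ] (1 ∸ w x) * lines-through x
      S = ∑[ x ∈ allProj ] w x * (lines-through x * lines-through x)
      S′ = ∑[ x ∈ allProj ] (1 ∸ w x) * (lines-through x * lines-through x)
      I+J≡ : incidences + J ≡ length L * (q + 1)
      I+J≡ = trans (cong (_+ J) (sym (Projs.∑-multiplicity P lines-through)))
                   (trans (∑-complement allProj w lines-through w≤1) ∑-lines-through)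
      S+S′≤ : S + S′ ≤ length L * (q + length L)
      S+S′≤ = ≤-trans (≤-reflexive (∑-complement allProj w (λ x → lines-through x * lines-through x) w≤1))
                      ∑-lines-through²
      I²≤ : incidences * incidences ≤ length P * S
      I²≤ = subst₂ (λ I a → I * I ≤ a * S)
        (Projs.∑-multiplicity P lines-through) (Projs.∑-multiplicity-length P)
        (cauchy-schwarz allProj w lines-through)
      J²≤ : J * J ≤ Projs.outside P * S′
      J²≤ = cauchy-schwarz allProj (λ x → 1 ∸ w x) lines-through

module LeviGraph (F : FiniteField) where

  open import Data.Nat using (_+_; _*_; _≤_)
  open import Data.Nat.Properties using (≤-trans; ≤-reflexive; module ≤-Reasoning)
  open import Data.List.Membership.Propositional.Properties using (∈-map⁻)
  open import Data.List.Relation.Unary.Unique.Propositional.Properties using (map⁺)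
  open Summation
  open Partition
  open Plane F using (incident?)
  open PlaneCounts F

  degree-point : ∀ K p → degreeIn (Levi F) K (inj₁ p) ≡ ∑[ l ∈ rights K ] 𝟙 (incident? p l)
  degree-point K p = trans (length-filter≡∑𝟙 (LeviAdj? F (inj₁ p)) K) (adjacent-lines K)
    where
    adjacent-lines : ∀ K → ∑[ v ∈ K ] 𝟙 (LeviAdj? F (inj₁ p) v) ≡ ∑[ l ∈ rights K ] 𝟙 (incident? p l)
    adjacent-lines []           = refl
    adjacent-lines (inj₁ _ ∷ K) = adjacent-lines K
    adjacent-lines (inj₂ l ∷ K) = cong (𝟙 (incident? p l) +_) (adjacent-lines K)

  degree-line : ∀ K l → degreeIn (Levi F) K (inj₂ l) ≡ ∑[ p ∈ lefts K ] 𝟙 (incident? p l)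
  degree-line K l = trans (length-filter≡∑𝟙 (LeviAdj? F (inj₂ l)) K) (adjacent-points K)
    where
    adjacent-points : ∀ K → ∑[ v ∈ K ] 𝟙 (LeviAdj? F (inj₂ l) v) ≡ ∑[ p ∈ lefts K ] 𝟙 (incident? p l)
    adjacent-points []           = refl
    adjacent-points (inj₁ p ∷ K) = cong (𝟙 (incident? p l) +_) (adjacent-points K)
    adjacent-points (inj₂ _ ∷ K) = adjacent-points K

  module _ {K} (K! : Unique K) {s} (Δ≤s : maxDegreeIn (Levi F) K ≤ s) where

    open Incidences (lefts-unique K!) (rights-unique K!)

    degree≤s : ∀ {v} → v ∈ K → degreeIn (Levi F) K v ≤ s
    degree≤s v∈K = ≤-trans (Degrees.degree≤maxDegree (Levi F) K v∈K) Δ≤s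

    incidences≤s*points : incidences ≤ s * length (lefts K)
    incidences≤s*points = ≤-trans
      (∑-mono∈-≤ (lefts K) (λ {p} p∈ → subst (_≤ s) (degree-point K p) (degree≤s (∈-lefts⁻ K p∈))))
      (≤-reflexive (∑-const (lefts K) s))

    incidences≤s*lines : incidences ≤ s * length (rights K)
    incidences≤s*lines = begin
      ∑[ p ∈ lefts K ] ∑[ l ∈ rights K ] 𝟙 (incident? p l)
        ≡⟨ ∑-comm (lefts K) (rights K) (λ p l → 𝟙 (incident? p l)) ⟩
      ∑[ l ∈ rights K ] ∑[ p ∈ lefts K ] 𝟙 (incident? p l)
        ≤⟨ ∑-mono∈-≤ (rights K) (λ {l} l∈ → subst (_≤ s) (degree-line K l) (degree≤s (∈-rights⁻ K l∈))) ⟩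
      ∑ (rights K) (λ _ → s)
        ≡⟨ ∑-const (rights K) s ⟩
      s * length (rights K) ∎
      where open ≤-Reasoning

  points-independent : Independent (Levi F) (map inj₁ allProj)
  points-independent u∈ v∈ with ∈-map⁻ inj₁ u∈ | ∈-map⁻ inj₁ v∈
  ... | _ , _ , refl | _ , _ , refl = λ ()

  length-allProj≤α : ∀ {α} → IsIndependenceNumber (Levi F) α → length allProj ≤ α
  length-allProj≤α (_ , α-max) = subst (_≤ _) (length-map inj₁ allProj)
    (α-max (map inj₁ allProj) (map⁺ inj₁-injective allProj-unique) points-independent)
    where
    inj₁-injective : ∀ {x y : Proj F} → inj₁ {B = Proj F} x ≡ inj₁ y → x ≡ y
    inj₁-injective refl = refl

open Arithmetic using (sigma-bound)
open Partition

open import Data.Nat using (ℕ; _+_; _*_; _∸_; _^_; _≤_; _<_)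
open import Data.Nat.Properties using (≤-reflexive; ≤-<-trans)

corollary7p2 : (F : FiniteField) → (s : ℕ) → IsSigma (Levi F) s →
    (FiniteField.order F + 1 ∸ 2 * s) ^ 2 < FiniteField.order F
corollary7p2 F s (α , α-is , (K , K! , α<|K| , Δ≡s) , _) =
  sigma-bound {q} {length allProj} {length P} {Projs.outside P} {length L} {Projs.outside L}
    {s} {incidences} 1≤q (Projs.length+outside P!) (Projs.length+outside L!)
    n<|P|+|L| (incidences≤s*points K! Δ≤s) (incidences≤s*lines K! Δ≤s) deficit
  where
  open PlaneCounts F
  open LeviGraph F
  P = lefts K
  L = rights K
  P! = lefts-unique K!
  L! = rights-unique K!
  open Incidences P! L!
  Δ≤s : maxDegreeIn (Levi F) K ≤ s
  Δ≤s = ≤-reflexive Δ≡s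
  n<|P|+|L| : length allProj < length P + length L
  n<|P|+|L| = ≤-<-trans (length-allProj≤α α-is) (subst (α <_) (length-lefts+rights K) α<|K|)
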